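{- Let $r\geq1$ and $n\geq1$. Then $0^{n}\in\mathcal{Z}(O\Gamma_{n}^{(1,r)})$ and $rad(O\Gamma_{n}^{(1,r)})=\lceil \frac{nr}{r+1}\rceil$. Furthermore: (1) if $n\equiv 0 \pmod{r+1}$, then $\mathcal{Z}(O\Gamma_{n}^{(1,r)})=\{0^{n}\}$ and $|\mathcal{Z}(O\Gamma_{n}^{(1,r)})|=1$; (2) if $n \bmod (r+1)=k\neq0$, then $\mathcal{Z}(O\Gamma_{n}^{(1,r)})=\mathcal{Z}(O\Gamma_{n-r-1}^{(1,r)})^{\vee}$, with initial set $\mathcal{Z}(O\Gamma_{k}^{(1,r)})$ equal to the set of all binary words of length $k$, and $$|\mathcal{Z}(O\Gamma_{n}^{(1,r)})|=\sum_{j=1}^{k+1}a_{j}\Big\lceil\frac{n}{r+1}\Big\rceil^{k+1-j},$$ where $(a_1,\ldots,a_{k+1})^{T}=A^{ -1}b$, $A$ is the $(k+1)\times(k+1)$ matrix whose $i$-th row is $(i^{k},i^{k-1},\ldots,i,1)$ for $i=1,\ldots,k+1$, and $b=(|\mathcal{Z}(O\Gamma_{k}^{(1,r)})|,|\mathcal{Z}(O\Gamma_{k+(r+1)}^{(1,r)})|,\ldots,|\mathcal{Z}(O\Gamma_{k+k(r+1)}^{(1,r)})|)^{T}$.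
   Context: For $r\ge1$, $n\ge1$, $O\Gamma_{n}^{(1,r)}$ is the graph whose vertices are the binary words of length $n$ containing no factor $1^{r+1}$ (no $r+1$ consecutive ones), two vertices being adjacent iff they differ in exactly one coordinate. $0^s$ and $1^s$ denote runs of $s$ zeros/ones. For a connected graph $G$, the eccentricity of $v$ is $e(v)=\max_{u}d(v,u)$, the radius is $rad(G)=\min_v e(v)$, and the center $\mathcal{Z}(G)$ is the set of vertices $v$ with $e(v)=rad(G)$. For a set $S$ of binary words of length $m$, $S^{\vee}$ denotes the set of words of length $m+r+1$ consisting of the words $0^{r+1}\eta$ for $\eta\in S$, together with, for each $\eta=g_1\ldots g_m\in S$ and each index $i$ with $g_i=1$, the word obtained from $\eta$ by inserting $0^{r+1}$ immediately after its $i$-th coordinate. -}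

module Defs where

open import Data.Bool using (Bool; true; false; not)
open import Data.Nat using (ℕ; zero; suc; _+_; _*_; _∸_; _^_; _≤_; _<_)
open import Data.Nat.DivMod using (_/_)
open import Data.Fin using (Fin; toℕ)
import Data.Fin as Fin
open import Data.Integer using (+_)
open import Data.Rational using (ℚ; 0ℚ) renaming (_+_ to _+ℚ_; _*_ to _*ℚ_)
import Data.Rational as ℚ
open import Data.List using (List; []; _∷_; _++_; replicate; length)
open import Data.List.Membership.Propositional using (_∈_)
open import Data.List.Relation.Unary.Unique.Propositional using (Unique)
open import Data.Product using (Σ; ∃; ∃-syntax; _×_; _,_)
open import Data.Sum using (_⊎_)
open import Relation.Nullary using (¬_)
open import Relation.Binary.PropositionalEquality using (_≡_)
open import Function.Bundles using (_⇔_)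

-- Binary words are lists of booleans (true = 1, false = 0).
Word : Set
Word = List Bool

HasOnesFactor : ℕ → Word → Set
HasOnesFactor r w = ∃[ p ] ∃[ s ] (w ≡ p ++ replicate (suc r) true ++ s)

Vertex : ℕ → ℕ → Word → Set
Vertex r n w = (length w ≡ n) × ¬ HasOnesFactor r w

Adj : Word → Word → Set
Adj u v = ∃[ p ] ∃[ b ] ∃[ s ] ((u ≡ p ++ b ∷ s) × (v ≡ p ++ not b ∷ s))

-- Walk r n u v m : a walk of length m from u to v in OΓ_n^{(1,r)}
-- (every vertex after the first is a vertex of the graph; the first is
--  assumed to be a vertex wherever walks are used)
data Walk (r n : ℕ) : Word → Word → ℕ → Set where
  here : ∀ {u} → Walk r n u u zero
  step : ∀ {u w v m} → Adj u w → Vertex r n w → Walk r n w v m → Walk r n u v (suc m)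

IsDist : ℕ → ℕ → Word → Word → ℕ → Set
IsDist r n u v d = Walk r n u v d × (∀ m → m < d → ¬ Walk r n u v m)

IsEcc : ℕ → ℕ → Word → ℕ → Set
IsEcc r n v e =
  (∀ u → Vertex r n u → ∃[ d ] (IsDist r n v u d × d ≤ e)) ×
  (∃[ u ] (Vertex r n u × IsDist r n v u e))

IsRad : ℕ → ℕ → ℕ → Set
IsRad r n ρ =
  (∃[ v ] (Vertex r n v × IsEcc r n v ρ)) ×
  (∀ v e → Vertex r n v → IsEcc r n v e → ρ ≤ e)

InCenter : ℕ → ℕ → Word → Set
InCenter r n w = Vertex r n w × ∃[ ρ ] (IsRad r n ρ × IsEcc r n w ρ)

HasSize : (Word → Set) → ℕ → Set
HasSize P c = ∃[ ls ] (Unique ls × (∀ w → (w ∈ ls) ⇔ P w) × (length ls ≡ c))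

Vee : ℕ → (Word → Set) → Word → Set
Vee r S x =
  (∃[ η ] (S η × (x ≡ replicate (suc r) false ++ η))) ⊎
  (∃[ η₁ ] ∃[ η₂ ] (S (η₁ ++ true ∷ η₂) ×
      (x ≡ η₁ ++ true ∷ (replicate (suc r) false ++ η₂))))

ceilDivSuc : ℕ → ℕ → ℕ
ceilDivSuc x d = (x + d) / suc d

ℕtoℚ : ℕ → ℚ
ℕtoℚ m = + m ℚ./ 1

sumℚ : (m : ℕ) → (Fin m → ℚ) → ℚ
sumℚ zero f = 0ℚ
sumℚ (suc m) f = f Fin.zero +ℚ sumℚ m (λ j → f (Fin.suc j))

-- (A a)_i for the (k+1)x(k+1) matrix A with row i (1-based) = (i^k, …, i, 1);
-- with 0-based indices i, j : Fin (k+1):  A i j = (i+1)^(k - j)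
VandApply : (k : ℕ) → (Fin (suc k) → ℚ) → Fin (suc k) → ℚ
VandApply k a i = sumℚ (suc k) (λ j → ℕtoℚ (suc (toℕ i) ^ (k ∸ toℕ j)) *ℚ a j)

-- Σ_{j=1}^{k+1} a_j C^{k+1-j}  (0-based j: a j * C^(k - j))
PolyEval : (k : ℕ) → (Fin (suc k) → ℚ) → ℕ → ℚ
PolyEval k a C = sumℚ (suc k) (λ j → a j *ℚ ℕtoℚ (C ^ (k ∸ toℕ j)))

-- Distances in OΓ_n^{(1,r)} are Hamming distances: its vertex set is closed under turning ones
-- into zeros, so any two vertices are joined by a shortest walk through their meet. The vertex
-- farthest from v is built greedily, flipping every bit of v unless that would create a run of
-- r+1 ones; bookkeeping along this scan gives (r+1)·e(v) = r·n + δ(v) with a defect δ(v) ≥ 0 and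
-- δ(0^n) ≤ r. Hence rad = ⌈nr/(r+1)⌉ and the center consists of the words with δ = n mod (r+1).
-- Inserting 0^(r+1) at the front or after a 1 does not change δ, and every central word of length
-- at least r+1 arises this way, which is the ∨-recursion. Splitting a central word at its first
-- 0^(r+1) or 0^i 1 yields recurrences showing that |Z| is a polynomial of degree k in
-- ⌈n/(r+1)⌉, so it is determined by its values at 1, …, k+1, i.e. by the Vandermonde system.

module Submission where

open import Defs

module FiniteDifferences where

  open import Data.Nat as ℕ using (ℕ; zero; suc; _≤_; z≤n; s≤s)
  import Data.Nat.Properties as ℕ
  open import Data.Nat.Coprimality using (1-coprimeTo) renaming (sym to coprime-sym)
  open import Data.Fin using (Fin; toℕ)
  import Data.Fin as Fin
  open import Data.Integer using (+_)
  import Data.Integer as ℤ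
  import Data.Integer.Properties as ℤ
  open import Data.Rational using (ℚ; mkℚ; 0ℚ; 1ℚ; _+_; _*_; _-_)
  import Data.Rational.Properties as ℚ
  import Data.Rational.Unnormalised as ℚᵘ
  import Data.Rational.Unnormalised.Properties as ℚᵘ
  open import Relation.Nullary using (dec⇒maybe)
  open import Relation.Binary.PropositionalEquality
  import Tactic.RingSolver.Core.AlmostCommutativeRing as ACR
  open import Tactic.RingSolver using (solve-∀)

  ℚ-ring : ACR.AlmostCommutativeRing _ _
  ℚ-ring = ACR.fromCommutativeRing ℚ.+-*-commutativeRing (λ x → dec⇒maybe (0ℚ ℚ.≟ x))

  private
    -- ℕtoℚ m in normal form, so that the homomorphism laws reduce to ℚᵘ
    normal : ℕ → ℚ
    normal m = mkℚ (+ m) 0 (coprime-sym (1-coprimeTo m))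

    ℕtoℚ-normal : ∀ m → ℕtoℚ m ≡ normal m
    ℕtoℚ-normal m = ℚ.↥p/↧p≡p (normal m)

  ℕtoℚ-+ : ∀ a b → ℕtoℚ (a ℕ.+ b) ≡ ℕtoℚ a + ℕtoℚ b
  ℕtoℚ-+ a b rewrite ℕtoℚ-normal a | ℕtoℚ-normal b | ℕtoℚ-normal (a ℕ.+ b) =
    ℚ.toℚᵘ-injective (ℚᵘ.≃-trans sum (ℚᵘ.≃-sym (ℚ.toℚᵘ-homo-+ (normal a) (normal b))))
    where
      sum : ℚᵘ.mkℚᵘ (+ (a ℕ.+ b)) 0 ℚᵘ.≃ (ℚᵘ.mkℚᵘ (+ a) 0 ℚᵘ.+ ℚᵘ.mkℚᵘ (+ b) 0)
      sum = ℚᵘ.*≡* (trans (ℤ.*-identityʳ _) (sym (trans (ℤ.*-identityʳ _)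
              (cong₂ ℤ._+_ (ℤ.*-identityʳ (+ a)) (ℤ.*-identityʳ (+ b))))))

  ℕtoℚ-* : ∀ a b → ℕtoℚ (a ℕ.* b) ≡ ℕtoℚ a * ℕtoℚ b
  ℕtoℚ-* a b rewrite ℕtoℚ-normal a | ℕtoℚ-normal b | ℕtoℚ-normal (a ℕ.* b) =
    ℚ.toℚᵘ-injective (ℚᵘ.≃-trans product (ℚᵘ.≃-sym (ℚ.toℚᵘ-homo-* (normal a) (normal b))))
    where
      product : ℚᵘ.mkℚᵘ (+ (a ℕ.* b)) 0 ℚᵘ.≃ (ℚᵘ.mkℚᵘ (+ a) 0 ℚᵘ.* ℚᵘ.mkℚᵘ (+ b) 0)
      product = ℚᵘ.*≡* (cong (ℤ._* + 1) (ℤ.pos-* a b))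

  Δ : (ℕ → ℚ) → ℕ → ℚ
  Δ f x = f (suc x) - f x

  DegreeAtMost : ℕ → (ℕ → ℚ) → Set
  DegreeAtMost zero    f = ∀ x → f (suc x) ≡ f x
  DegreeAtMost (suc d) f = DegreeAtMost d (Δ f)

  private
    sub-self : ∀ a → a - a ≡ 0ℚ
    sub-self = ℚ.+-inverseʳ

    +-sub-interchange : ∀ a b c d → (a + b) - (c + d) ≡ (a - c) + (b - d)
    +-sub-interchange = solve-∀ ℚ-ring

    sub-sub-interchange : ∀ a b c d → (a - b) - (c - d) ≡ (a - c) - (b - d)
    sub-sub-interchange = solve-∀ ℚ-ring

    *-sub-distrib : ∀ c a b → c * a - c * b ≡ c * (a - b)
    *-sub-distrib = solve-∀ ℚ-ring

    sub-+-cancel : ∀ a b → (a - b) + b ≡ a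
    sub-+-cancel = solve-∀ ℚ-ring

    +-sub-cancel : ∀ a b → (a + b) - a ≡ b
    +-sub-cancel = solve-∀ ℚ-ring

    product-rule : ∀ n a b → (1ℚ + n) * b - n * a ≡ n * (b - a) + b
    product-rule = solve-∀ ℚ-ring

  Δ-increment : ∀ {g h : ℕ → ℕ} → (∀ x → g (suc x) ≡ g x ℕ.+ h x) →
                ∀ x → Δ (λ y → ℕtoℚ (g y)) x ≡ ℕtoℚ (h x)
  Δ-increment {g} {h} increments x =
    trans (cong (_- ℕtoℚ (g x)) (trans (cong ℕtoℚ (increments x)) (ℕtoℚ-+ (g x) (h x))))
          (+-sub-cancel (ℕtoℚ (g x)) (ℕtoℚ (h x)))

  degree-cong : ∀ d {f g} → DegreeAtMost d f → (∀ x → f x ≡ g x) → DegreeAtMost d g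
  degree-cong zero    df f≗g x = trans (sym (f≗g (suc x))) (trans (df x) (f≗g x))
  degree-cong (suc d) df f≗g   = degree-cong d df (λ x → cong₂ _-_ (f≗g (suc x)) (f≗g x))

  degree-+ : ∀ d {f g} → DegreeAtMost d f → DegreeAtMost d g → DegreeAtMost d (λ x → f x + g x)
  degree-+ zero    df dg x = cong₂ _+_ (df x) (dg x)
  degree-+ (suc d) {f} {g} df dg =
    degree-cong d (degree-+ d df dg) (λ x → sym (+-sub-interchange (f (suc x)) (g (suc x)) (f x) (g x)))

  degree-- : ∀ d {f g} → DegreeAtMost d f → DegreeAtMost d g → DegreeAtMost d (λ x → f x - g x)
  degree-- zero    df dg x = cong₂ _-_ (df x) (dg x)
  degree-- (suc d) {f} {g} df dg =
    degree-cong d (degree-- d df dg) (λ x → sym (sub-sub-interchange (f (suc x)) (g (suc x)) (f x) (g x)))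

  degree-scale : ∀ d c {f} → DegreeAtMost d f → DegreeAtMost d (λ x → c * f x)
  degree-scale zero    c df x = cong (c *_) (df x)
  degree-scale (suc d) c {f} df =
    degree-cong d (degree-scale d c df) (λ x → sym (*-sub-distrib c (f (suc x)) (f x)))

  degree-const : ∀ d c → DegreeAtMost d (λ _ → c)
  degree-const zero    c x = refl
  degree-const (suc d) c   = degree-cong d (degree-const d 0ℚ) (λ x → sym (sub-self c))

  degree-suc : ∀ d {f} → DegreeAtMost d f → DegreeAtMost (suc d) f
  degree-suc zero {f} df x = trans (cong (_- f (suc x)) (df (suc x)))
                            (trans (sub-self (f (suc x))) (sym (trans (cong (_- f x) (df x)) (sub-self (f x)))))
  degree-suc (suc d) df = degree-suc d df

  degree-≤ : ∀ {d e f} → d ≤ e → DegreeAtMost d f → DegreeAtMost e f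
  degree-≤ {zero}  {zero}  z≤n       df = df
  degree-≤ {zero}  {suc e} z≤n       df = degree-suc e (degree-≤ {zero} {e} z≤n df)
  degree-≤ {suc d} {suc e} (s≤s d≤e) df = degree-≤ {d} {e} d≤e df

  degree-shift : ∀ d {f} → DegreeAtMost d f → DegreeAtMost d (λ x → f (suc x))
  degree-shift zero    df x = df (suc x)
  degree-shift (suc d) df   = degree-shift d df

  degree-vanish : ∀ d {f} → DegreeAtMost d f → (∀ i → i ≤ d → f i ≡ 0ℚ) → ∀ x → f x ≡ 0ℚ
  degree-vanish zero    {f} df zero-below x = constant x
    where
      constant : ∀ x → f x ≡ 0ℚ
      constant zero    = zero-below 0 z≤n
      constant (suc x) = trans (df x) (constant x)
  degree-vanish (suc d) {f} df zero-below = vanish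
    where
      Δf≡0 : ∀ x → Δ f x ≡ 0ℚ
      Δf≡0 = degree-vanish d df (λ i i≤d →
        trans (cong₂ _-_ (zero-below (suc i) (s≤s i≤d)) (zero-below i (ℕ.≤-trans i≤d (ℕ.n≤1+n d))))
              (sub-self 0ℚ))
      vanish : ∀ x → f x ≡ 0ℚ
      vanish zero    = zero-below 0 z≤n
      vanish (suc x) = trans (sym (sub-+-cancel (f (suc x)) (f x)))
                             (trans (cong₂ _+_ (Δf≡0 x) (vanish x)) (ℚ.+-identityˡ 0ℚ))

  degree-agree : ∀ d {f g} → DegreeAtMost d f → DegreeAtMost d g →
                 (∀ i → i ≤ d → f i ≡ g i) → ∀ x → f x ≡ g x
  degree-agree d {f} {g} df dg agree x =
    trans (sym (sub-+-cancel (f x) (g x)))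
          (trans (cong (_+ g x) (degree-vanish d (degree-- d df dg)
                                  (λ i i≤d → trans (cong (_- g i) (agree i i≤d)) (sub-self (g i))) x))
                 (ℚ.+-identityˡ (g x)))

  Δ-mulSuc : ∀ f x → Δ (λ y → ℕtoℚ (suc y) * f y) x ≡ ℕtoℚ (suc x) * Δ f x + f (suc x)
  Δ-mulSuc f x = trans (cong (λ c → c * f (suc x) - ℕtoℚ (suc x) * f x) (ℕtoℚ-+ 1 (suc x)))
                       (product-rule (ℕtoℚ (suc x)) (f x) (f (suc x)))

  degree-mulSuc : ∀ d {f} → DegreeAtMost d f → DegreeAtMost (suc d) (λ x → ℕtoℚ (suc x) * f x)
  degree-mulSuc zero {f} df = degree-cong 0 (degree-shift 0 df) (λ x → sym (begin
    Δ (λ y → ℕtoℚ (suc y) * f y) x      ≡⟨ Δ-mulSuc f x ⟩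
    ℕtoℚ (suc x) * Δ f x + f (suc x)    ≡⟨ cong (λ c → ℕtoℚ (suc x) * c + f (suc x))
                                                (trans (cong (_- f x) (df x)) (sub-self (f x))) ⟩
    ℕtoℚ (suc x) * 0ℚ + f (suc x)       ≡⟨ cong (_+ f (suc x)) (ℚ.*-zeroʳ (ℕtoℚ (suc x))) ⟩
    0ℚ + f (suc x)                      ≡⟨ ℚ.+-identityˡ (f (suc x)) ⟩
    f (suc x)                           ∎))
    where open ≡-Reasoning
  degree-mulSuc (suc d) {f} df =
    degree-cong (suc d) (degree-+ (suc d) {λ x → ℕtoℚ (suc x) * Δ f x} {λ x → f (suc x)}
                                   (degree-mulSuc d df) (degree-shift (suc d) {f} df))
                        (λ x → sym (Δ-mulSuc f x))

  degree-pow : ∀ e → DegreeAtMost e (λ x → ℕtoℚ (suc x ℕ.^ e))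
  degree-pow zero    x = refl
  degree-pow (suc e) = degree-cong (suc e) (degree-mulSuc e (degree-pow e))
                                   (λ x → sym (ℕtoℚ-* (suc x) (suc x ℕ.^ e)))

  sumℚ-cong : ∀ n {f g : Fin n → ℚ} → (∀ j → f j ≡ g j) → sumℚ n f ≡ sumℚ n g
  sumℚ-cong zero    f≗g = refl
  sumℚ-cong (suc n) f≗g = cong₂ _+_ (f≗g Fin.zero) (sumℚ-cong n (λ j → f≗g (Fin.suc j)))

  degree-sumℚ : ∀ d n (F : Fin n → ℕ → ℚ) → (∀ j → DegreeAtMost d (F j)) →
                DegreeAtMost d (λ x → sumℚ n (λ j → F j x))
  degree-sumℚ d zero    F dF = degree-const d 0ℚ
  degree-sumℚ d (suc n) F dF =
    degree-+ d (dF Fin.zero) (degree-sumℚ d n (λ j → F (Fin.suc j)) (λ j → dF (Fin.suc j)))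

  polyEval-degree : ∀ k a → DegreeAtMost k (λ x → PolyEval k a (suc x))
  polyEval-degree k a = degree-sumℚ k (suc k) _
    (λ j → degree-scale k (a j) (degree-≤ (ℕ.m∸n≤m k (toℕ j)) (degree-pow (k ℕ.∸ toℕ j))))

  vandApply≡polyEval : ∀ k a i → VandApply k a i ≡ PolyEval k a (suc (toℕ i))
  vandApply≡polyEval k a i =
    sumℚ-cong (suc k) (λ j → ℚ.*-comm (ℕtoℚ (suc (toℕ i) ℕ.^ (k ℕ.∸ toℕ j))) (a j))

open FiniteDifferences

open import Data.Bool using (Bool; true; false; not; _∧_)
open import Data.Nat
open import Data.Nat.Properties
open import Data.Nat.DivMod
open import Data.Nat.Divisibility using (divides)
open import Data.Nat.Tactic.RingSolver using (solve)
open import Data.Fin using (Fin; toℕ; fromℕ<)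
open import Data.Fin.Properties using (toℕ-fromℕ<)
open import Data.List using ([]; _∷_; _++_; replicate; length; map)
open import Data.List.Properties
  using (++-assoc; length-++; length-map; length-replicate; ++-cancelˡ; ∷-injectiveʳ)
open import Data.List.Membership.Propositional.Properties
  using (∈-map⁺; ∈-map⁻; ∈-++⁺ˡ; ∈-++⁺ʳ; ∈-++⁻)
open import Data.List.Membership.Propositional.Properties.WithK using (unique∧set⇒bag)
open import Data.List.Relation.Unary.Any using (here)
open import Data.List.Relation.Unary.All using ([])
open import Data.List.Relation.Unary.AllPairs using ([]; _∷_)
import Data.List.Relation.Unary.Unique.Propositional.Properties as Unique
open import Data.List.Relation.Binary.BagAndSetEquality using (∼bag⇒↭)
open import Data.List.Relation.Binary.Permutation.Propositional.Properties using (↭-length)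
open import Data.Rational using (ℚ)
open import Data.Product using (∃; ∃₂; _×_; _,_; proj₁; proj₂; map₂)
open import Data.Sum using (_⊎_; inj₁; inj₂; [_,_])
import Data.Sum as Sum
open import Data.Unit using (⊤; tt)
open import Data.Empty using (⊥; ⊥-elim)
open import Relation.Nullary using (¬_; Dec; yes; no; decidable-stable)
open import Relation.Binary.PropositionalEquality
  using (_≡_; _≢_; refl; sym; trans; cong; cong₂; subst; module ≡-Reasoning)
open import Function.Bundles using (_⇔_; mk⇔; Equivalence)
import Function.Properties.Equivalence as ⇔

zeros : ℕ → Word
zeros n = replicate n false

ones : Word → ℕ
ones []          = 0
ones (true ∷ x)  = suc (ones x)
ones (false ∷ x) = ones x

replicate-snoc : ∀ j (x : Bool) l → replicate j x ++ x ∷ l ≡ x ∷ replicate j x ++ l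
replicate-snoc zero    x l = refl
replicate-snoc (suc j) x l = cong (x ∷_) (replicate-snoc j x l)

infix 4 _⊑_

data _⊑_ : Word → Word → Set where
  []    : [] ⊑ []
  same  : ∀ b {x y} → x ⊑ y → b ∷ x ⊑ b ∷ y
  raise : ∀ {x y} → x ⊑ y → false ∷ x ⊑ true ∷ y

⊑-refl : ∀ x → x ⊑ x
⊑-refl []      = []
⊑-refl (b ∷ x) = same b (⊑-refl x)

⊑-length : ∀ {x y} → x ⊑ y → length x ≡ length y
⊑-length []        = refl
⊑-length (same b p) = cong suc (⊑-length p)
⊑-length (raise p)  = cong suc (⊑-length p)

DownClosed : (Word → Set) → Set
DownClosed P = ∀ {x y} → x ⊑ y → P y → P x

hamming : Word → Word → ℕ
hamming []          _           = 0
hamming (_ ∷ _)     []          = 0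
hamming (false ∷ x) (false ∷ y) = hamming x y
hamming (true ∷ x)  (true ∷ y)  = hamming x y
hamming (false ∷ x) (true ∷ y)  = suc (hamming x y)
hamming (true ∷ x)  (false ∷ y) = suc (hamming x y)

hamming-self : ∀ x → hamming x x ≡ 0
hamming-self []          = refl
hamming-self (false ∷ x) = hamming-self x
hamming-self (true ∷ x)  = hamming-self x

hamming-adj : ∀ {u w} v → Adj u w → hamming u v ≤ suc (hamming w v)
hamming-adj v (p , b , s , refl , refl) = flip p b v
  where
    flip : ∀ p b v → hamming (p ++ b ∷ s) v ≤ suc (hamming (p ++ not b ∷ s) v)
    flip []          b     []          = z≤n
    flip []          false (false ∷ v) = ≤-trans (n≤1+n _) (n≤1+n _)
    flip []          false (true ∷ v)  = ≤-refl
    flip []          true  (false ∷ v) = ≤-refl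
    flip []          true  (true ∷ v)  = ≤-trans (n≤1+n _) (n≤1+n _)
    flip (a ∷ p)     b     []          = z≤n
    flip (false ∷ p) b     (false ∷ v) = flip p b v
    flip (true ∷ p)  b     (true ∷ v)  = flip p b v
    flip (false ∷ p) b     (true ∷ v)  = s≤s (flip p b v)
    flip (true ∷ p)  b     (false ∷ v) = s≤s (flip p b v)

data WalkIn (P : Word → Set) : Word → Word → ℕ → Set where
  here : ∀ {u} → WalkIn P u u 0
  step : ∀ {u w v m} → Adj u w → P w → WalkIn P w v m → WalkIn P u v (suc m)

walkIn-++ : ∀ {P u w v m k} → WalkIn P u w m → WalkIn P w v k → WalkIn P u v (m + k)
walkIn-++ here           q = q
walkIn-++ (step a p w) q = step a p (walkIn-++ w q)

adj-∷ : ∀ b {u w} → Adj u w → Adj (b ∷ u) (b ∷ w)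
adj-∷ b (p , c , s , refl , refl) = b ∷ p , c , s , refl , refl

walkIn-∷ : ∀ {P} b {u v m} → WalkIn (λ z → P (b ∷ z)) u v m → WalkIn P (b ∷ u) (b ∷ v) m
walkIn-∷ b here         = here
walkIn-∷ b (step a p w) = step (adj-∷ b a) p (walkIn-∷ b w)

ascend : ∀ {P x y} → x ⊑ y → (∀ z → z ⊑ y → P z) → WalkIn P x y (hamming x y)
ascend []             h = here
ascend (same false p) h = walkIn-∷ false (ascend p (λ z q → h (false ∷ z) (same false q)))
ascend (same true p)  h = walkIn-∷ true (ascend p (λ z q → h (true ∷ z) (same true q)))
ascend {x = false ∷ x} (raise p) h =
  step ([] , false , x , refl , refl) (h (true ∷ x) (same true p))
       (walkIn-∷ true (ascend p (λ z q → h (true ∷ z) (same true q))))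

descend : ∀ {P x y} → x ⊑ y → (∀ z → z ⊑ y → P z) → WalkIn P y x (hamming y x)
descend []             h = here
descend (same false p) h = walkIn-∷ false (descend p (λ z q → h (false ∷ z) (same false q)))
descend (same true p)  h = walkIn-∷ true (descend p (λ z q → h (true ∷ z) (same true q)))
descend {y = true ∷ y} (raise p) h =
  step ([] , true , y , refl , refl) (h (false ∷ y) (raise (⊑-refl y)))
       (walkIn-∷ false (descend p (λ z q → h (false ∷ z) (raise q))))

meet : Word → Word → Word
meet []      _       = []
meet (_ ∷ _) []      = []
meet (a ∷ x) (b ∷ y) = (a ∧ b) ∷ meet x y

meet-⊑ˡ : ∀ u v → length u ≡ length v → meet u v ⊑ u
meet-⊑ˡ []          []          e = []
meet-⊑ˡ (false ∷ u) (b ∷ v)     e = same false (meet-⊑ˡ u v (suc-injective e))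
meet-⊑ˡ (true ∷ u)  (false ∷ v) e = raise (meet-⊑ˡ u v (suc-injective e))
meet-⊑ˡ (true ∷ u)  (true ∷ v)  e = same true (meet-⊑ˡ u v (suc-injective e))

meet-⊑ʳ : ∀ u v → length u ≡ length v → meet u v ⊑ v
meet-⊑ʳ []          []          e = []
meet-⊑ʳ (false ∷ u) (false ∷ v) e = same false (meet-⊑ʳ u v (suc-injective e))
meet-⊑ʳ (false ∷ u) (true ∷ v)  e = raise (meet-⊑ʳ u v (suc-injective e))
meet-⊑ʳ (true ∷ u)  (b ∷ v)     e = same b (meet-⊑ʳ u v (suc-injective e))

hamming-meet : ∀ u v → hamming u (meet u v) + hamming (meet u v) v ≡ hamming u v
hamming-meet []          v           = refl
hamming-meet (a ∷ u)     []          = refl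
hamming-meet (false ∷ u) (false ∷ v) = hamming-meet u v
hamming-meet (false ∷ u) (true ∷ v)  = trans (+-suc _ _) (cong suc (hamming-meet u v))
hamming-meet (true ∷ u)  (false ∷ v) = cong suc (hamming-meet u v)
hamming-meet (true ∷ u)  (true ∷ v)  = hamming-meet u v

walkIn-hamming : ∀ {P u v} → DownClosed P → P u → P v → length u ≡ length v →
                 WalkIn P u v (hamming u v)
walkIn-hamming {P} {u} {v} closed pu pv e = subst (WalkIn P u v) (hamming-meet u v)
  (walkIn-++ (descend (meet-⊑ˡ u v e) (λ z q → closed q pu))
             (ascend  (meet-⊑ʳ u v e) (λ z q → closed q pv)))

module _ (r : ℕ) where

  -- ShortRuns s w: the leading run of ones of w has length ≤ s, every later run ≤ r.
  ShortRuns : ℕ → Word → Set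
  ShortRuns s       []          = ⊤
  ShortRuns s       (false ∷ w) = ShortRuns r w
  ShortRuns zero    (true ∷ w)  = ⊥
  ShortRuns (suc s) (true ∷ w)  = ShortRuns s w

  shortRuns? : ∀ s w → Dec (ShortRuns s w)
  shortRuns? s       []          = yes tt
  shortRuns? s       (false ∷ w) = shortRuns? r w
  shortRuns? zero    (true ∷ w)  = no λ ()
  shortRuns? (suc s) (true ∷ w)  = shortRuns? s w

  shortRuns-mono : ∀ {s t} w → s ≤ t → ShortRuns s w → ShortRuns t w
  shortRuns-mono []          s≤t       ok = tt
  shortRuns-mono (false ∷ w) s≤t       ok = ok
  shortRuns-mono (true ∷ w)  (s≤s s≤t) ok = shortRuns-mono w s≤t ok

  shortRuns-⊑ : ∀ {s x y} → s ≤ r → x ⊑ y → ShortRuns s y → ShortRuns s x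
  shortRuns-⊑                 s≤r []             ok = tt
  shortRuns-⊑                 s≤r (same false p) ok = shortRuns-⊑ ≤-refl p ok
  shortRuns-⊑ {suc s}         s≤r (same true p)  ok = shortRuns-⊑ (<⇒≤ s≤r) p ok
  shortRuns-⊑ {suc s} {y = true ∷ y} s≤r (raise p) ok =
    shortRuns-⊑ ≤-refl p (shortRuns-mono y (<⇒≤ s≤r) ok)

  private
    run-bound : ∀ s j t → ShortRuns s (replicate (suc j) true ++ t) → j < s
    run-bound (suc s) zero    t ok = s≤s z≤n
    run-bound (suc s) (suc j) t ok = s≤s (run-bound s j t ok)

    no-long-run : ∀ p s t → s ≤ r → ¬ ShortRuns s (p ++ replicate (suc r) true ++ t)
    no-long-run []          s       t s≤r ok = <⇒≱ (run-bound s r t ok) s≤r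
    no-long-run (false ∷ p) s       t s≤r ok = no-long-run p r t ≤-refl ok
    no-long-run (true ∷ p)  (suc s) t s≤r ok = no-long-run p s t (<⇒≤ s≤r) ok

    long-run : ∀ s j w → j + s ≡ r → ¬ ShortRuns s w → HasOnesFactor r (replicate j true ++ w)
    long-run s       j []          e bad = ⊥-elim (bad tt)
    long-run s       j (false ∷ w) e bad with long-run r 0 w refl bad
    ... | p , t , refl = replicate j true ++ false ∷ p , t , sym (++-assoc (replicate j true) (false ∷ p) _)
    long-run zero    j (true ∷ w)  e bad = [] , w ,
      trans (replicate-snoc j true w)
            (cong (λ k → true ∷ replicate k true ++ w) (trans (sym (+-identityʳ j)) e))
    long-run (suc s) j (true ∷ w)  e bad = subst (HasOnesFactor r) (sym (replicate-snoc j true w))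
      (long-run s (suc j) w (trans (sym (+-suc j s)) e) bad)

  shortRuns⇔noOnesFactor : ∀ w → ShortRuns r w ⇔ (¬ HasOnesFactor r w)
  shortRuns⇔noOnesFactor w = mk⇔
    (λ { ok (p , t , refl) → no-long-run p r t ≤-refl ok })
    (λ noFactor → decidable-stable (shortRuns? r w) (λ bad → noFactor (long-run r 0 w refl bad)))

module _ (r n : ℕ) where

  vertex⇔ : ∀ w → Vertex r n w ⇔ (length w ≡ n × ShortRuns r r w)
  vertex⇔ w = mk⇔ (map₂ (Equivalence.from (shortRuns⇔noOnesFactor r w)))
                  (map₂ (Equivalence.to (shortRuns⇔noOnesFactor r w)))

  vertex-downClosed : DownClosed (Vertex r n)
  vertex-downClosed {x} {y} p vy with Equivalence.to (vertex⇔ y) vy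
  ... | len , ok = Equivalence.from (vertex⇔ x) (trans (⊑-length p) len , shortRuns-⊑ r ≤-refl p ok)

  walkIn⇒walk : ∀ {u v m} → WalkIn (Vertex r n) u v m → Walk r n u v m
  walkIn⇒walk here         = here
  walkIn⇒walk (step a p w) = step a p (walkIn⇒walk w)

  hamming≤walk : ∀ {u v m} → Walk r n u v m → hamming u v ≤ m
  hamming≤walk {u} here         = ≤-reflexive (hamming-self u)
  hamming≤walk {v = v} (step a _ w) = ≤-trans (hamming-adj v a) (s≤s (hamming≤walk w))

  isDist-hamming : ∀ {u v} → Vertex r n u → Vertex r n v → IsDist r n u v (hamming u v)
  isDist-hamming vu vv =
    walkIn⇒walk (walkIn-hamming vertex-downClosed vu vv (trans (proj₁ vu) (sym (proj₁ vv)))) ,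
    λ m m<h w → <⇒≱ m<h (hamming≤walk w)

  isDist⇒≡hamming : ∀ {u v d} → Vertex r n u → Vertex r n v → IsDist r n u v d → d ≡ hamming u v
  isDist⇒≡hamming vu vv (w , minimal) =
    ≤-antisym (≮⇒≥ λ h<d → minimal _ h<d (proj₁ (isDist-hamming vu vv))) (hamming≤walk w)

module _ (r : ℕ) where

  -- Scanning left to right, flip every bit unless that would extend the current
  -- run of ones beyond r; s is how many more ones the current run may take.
  farthest : ℕ → Word → Word
  farthest s       []          = []
  farthest s       (true ∷ x)  = false ∷ farthest r x
  farthest zero    (false ∷ x) = false ∷ farthest r x
  farthest (suc s) (false ∷ x) = true ∷ farthest s x

  farDist : ℕ → Word → ℕ
  farDist s       []          = 0
  farDist s       (true ∷ x)  = suc (farDist r x)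
  farDist zero    (false ∷ x) = farDist r x
  farDist (suc s) (false ∷ x) = suc (farDist s x)

  farthest-length : ∀ s x → length (farthest s x) ≡ length x
  farthest-length s       []          = refl
  farthest-length s       (true ∷ x)  = cong suc (farthest-length r x)
  farthest-length zero    (false ∷ x) = cong suc (farthest-length r x)
  farthest-length (suc s) (false ∷ x) = cong suc (farthest-length s x)

  farthest-shortRuns : ∀ s x → ShortRuns r s (farthest s x)
  farthest-shortRuns s       []          = tt
  farthest-shortRuns s       (true ∷ x)  = farthest-shortRuns r x
  farthest-shortRuns zero    (false ∷ x) = farthest-shortRuns r x
  farthest-shortRuns (suc s) (false ∷ x) = farthest-shortRuns s x

  hamming-farthest : ∀ s x → hamming x (farthest s x) ≡ farDist s x
  hamming-farthest s       []          = refl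
  hamming-farthest s       (true ∷ x)  = cong suc (hamming-farthest r x)
  hamming-farthest zero    (false ∷ x) = hamming-farthest r x
  hamming-farthest (suc s) (false ∷ x) = cong suc (hamming-farthest s x)

  mutual
    farDist-mono : ∀ x {s t} → s ≤ t → t ≤ r → farDist s x ≤ farDist t x
    farDist-mono []          _         _   = z≤n
    farDist-mono (true ∷ x)  _         _   = ≤-refl
    farDist-mono (false ∷ x) {zero} {zero}  _ _ = ≤-refl
    farDist-mono (false ∷ x) {zero} {suc t} _ t<r = farDist-≤suc x ≤-refl
    farDist-mono (false ∷ x) (s≤s s≤t) t<r = s≤s (farDist-mono x s≤t (<⇒≤ t<r))

    farDist-≤suc : ∀ x {s t} → t ≤ r → farDist t x ≤ suc (farDist s x)
    farDist-≤suc []          _   = z≤n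
    farDist-≤suc (true ∷ x)  _   = n≤1+n _
    farDist-≤suc (false ∷ x) {zero}  {zero}  _   = n≤1+n _
    farDist-≤suc (false ∷ x) {suc s} {zero}  _   = ≤-trans (farDist-≤suc x ≤-refl) (n≤1+n _)
    farDist-≤suc (false ∷ x) {zero}  {suc t} t<r = s≤s (farDist-mono x (<⇒≤ t<r) ≤-refl)
    farDist-≤suc (false ∷ x) {suc s} {suc t} t<r = s≤s (farDist-≤suc x (<⇒≤ t<r))

  hamming≤farDist : ∀ {s} x u → s ≤ r → ShortRuns r s u → hamming x u ≤ farDist s x
  hamming≤farDist []          u           s≤r ok = z≤n
  hamming≤farDist (b ∷ x)     []          s≤r ok = z≤n
  hamming≤farDist (true ∷ x)  (false ∷ u) s≤r ok = s≤s (hamming≤farDist x u ≤-refl ok)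
  hamming≤farDist {suc s} (true ∷ x) (true ∷ u) s≤r ok =
    ≤-trans (hamming≤farDist x u (<⇒≤ s≤r) ok) (≤-trans (farDist-mono x (<⇒≤ s≤r) ≤-refl) (n≤1+n _))
  hamming≤farDist {zero}  (false ∷ x) (false ∷ u) s≤r ok = hamming≤farDist x u ≤-refl ok
  hamming≤farDist {suc s} (false ∷ x) (false ∷ u) s≤r ok =
    ≤-trans (hamming≤farDist x u ≤-refl ok) (farDist-≤suc x ≤-refl)
  hamming≤farDist {suc s} (false ∷ x) (true ∷ u)  s≤r ok = s≤s (hamming≤farDist x u (<⇒≤ s≤r) ok)

module _ (r n : ℕ) where

  farthest-vertex : ∀ {v} → Vertex r n v → Vertex r n (farthest r r v)
  farthest-vertex {v} (len , _) = Equivalence.from (vertex⇔ r n _)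
    (trans (farthest-length r r v) len , farthest-shortRuns r r v)

  isEcc-farDist : ∀ {v} → Vertex r n v → IsEcc r n v (farDist r r v)
  isEcc-farDist {v} vv =
    (λ u vu → hamming v u , isDist-hamming r n vv vu ,
              hamming≤farDist r v u ≤-refl (proj₂ (Equivalence.to (vertex⇔ r n u) vu))) ,
    (farthest r r v , farthest-vertex vv ,
     subst (IsDist r n v _) (hamming-farthest r r v) (isDist-hamming r n vv (farthest-vertex vv)))

  isEcc⇒≡farDist : ∀ {v e} → Vertex r n v → IsEcc r n v e → e ≡ farDist r r v
  isEcc⇒≡farDist {v} {e} vv (bounded , u , vu , du) with bounded _ (farthest-vertex vv)
  ... | d , dd , d≤e = ≤-antisym
    (subst (_≤ farDist r r v) (sym (isDist⇒≡hamming r n vv vu du))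
           (hamming≤farDist r v u ≤-refl (proj₂ (Equivalence.to (vertex⇔ r n u) vu))))
    (subst (_≤ e) (trans (isDist⇒≡hamming r n vv (farthest-vertex vv) dd) (hamming-farthest r r v)) d≤e)

module _ (r : ℕ) where

  -- Chosen so that (r+1)·farDist r r x = r·length x + defect x; the extra argument u = r ∸ s
  -- counts the ones already placed in the current run of the farthest word.
  defectFrom : ℕ → ℕ → Word → ℕ
  defectFrom s       u []          = u
  defectFrom s       u (true ∷ x)  = suc (u + defectFrom r 0 x)
  defectFrom zero    u (false ∷ x) = defectFrom r 0 x
  defectFrom (suc s) u (false ∷ x) = defectFrom s (suc u) x

  defect : Word → ℕ
  defect = defectFrom r 0

  farDist-defectFrom : ∀ x s u → s + u ≡ r →
                       suc r * farDist r s x + u ≡ r * length x + defectFrom s u x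
  farDist-defectFrom []          s       u e    = cong (_+ u) (trans (*-zeroʳ (suc r)) (sym (*-zeroʳ r)))
  farDist-defectFrom (true ∷ x)  s       u e    = flipOne (farDist-defectFrom x r 0 (+-identityʳ r))
    where
      flipOne : ∀ {F L D} → suc r * F + 0 ≡ r * L + D → suc r * suc F + u ≡ r * suc L + suc (u + D)
      flipOne {F} {L} {D} ih = begin
        suc r * suc F + u               ≡⟨ solve (r ∷ F ∷ u ∷ []) ⟩
        (suc r * F + 0) + (suc r + u)   ≡⟨ cong (_+ (suc r + u)) ih ⟩
        (r * L + D) + (suc r + u)       ≡⟨ solve (r ∷ L ∷ D ∷ u ∷ []) ⟩
        r * suc L + suc (u + D)         ∎
        where open ≡-Reasoning
  farDist-defectFrom (false ∷ x) zero    .r refl = keepZero (farDist-defectFrom x r 0 (+-identityʳ r))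
    where
      keepZero : ∀ {F L D} → suc r * F + 0 ≡ r * L + D → suc r * F + r ≡ r * suc L + D
      keepZero {F} {L} {D} ih = begin
        suc r * F + r                   ≡⟨ cong (_+ r) (sym (+-identityʳ _)) ⟩
        (suc r * F + 0) + r             ≡⟨ cong (_+ r) ih ⟩
        (r * L + D) + r                 ≡⟨ solve (r ∷ L ∷ D ∷ []) ⟩
        r * suc L + D                   ∎
        where open ≡-Reasoning
  farDist-defectFrom (false ∷ x) (suc s) u e    =
    flipZero (farDist-defectFrom x s (suc u) (trans (+-suc s u) e))
    where
      flipZero : ∀ {F L D} → suc r * F + suc u ≡ r * L + D → suc r * suc F + u ≡ r * suc L + D
      flipZero {F} {L} {D} ih = begin
        suc r * suc F + u               ≡⟨ solve (r ∷ F ∷ u ∷ []) ⟩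
        (suc r * F + suc u) + r         ≡⟨ cong (_+ r) ih ⟩
        (r * L + D) + r                 ≡⟨ solve (r ∷ L ∷ D ∷ []) ⟩
        r * suc L + D                   ∎
        where open ≡-Reasoning

  farDist-defect : ∀ x → suc r * farDist r r x ≡ r * length x + defect x
  farDist-defect x = trans (sym (+-identityʳ _)) (farDist-defectFrom x r 0 (+-identityʳ r))

  ones≤defectFrom : ∀ x s u → ones x ≤ defectFrom s u x
  ones≤defectFrom []          s       u = z≤n
  ones≤defectFrom (true ∷ x)  s       u = s≤s (≤-trans (ones≤defectFrom x r 0) (m≤n+m _ u))
  ones≤defectFrom (false ∷ x) zero    u = ones≤defectFrom x r 0
  ones≤defectFrom (false ∷ x) (suc s) u = ones≤defectFrom x s (suc u)

  ones≤⇒shortRuns : ∀ x {s} → ones x ≤ s → s ≤ r → ShortRuns r s x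
  ones≤⇒shortRuns []          _         s≤r = tt
  ones≤⇒shortRuns (false ∷ x) o≤s       s≤r = ones≤⇒shortRuns x (≤-trans o≤s s≤r) ≤-refl
  ones≤⇒shortRuns (true ∷ x)  (s≤s o≤s) s≤r = ones≤⇒shortRuns x o≤s (<⇒≤ s≤r)

  defect≤⇒vertex : ∀ n w → length w ≡ n → defect w ≤ r → Vertex r n w
  defect≤⇒vertex n w len d≤r = Equivalence.from (vertex⇔ r n w)
    (len , ones≤⇒shortRuns w (≤-trans (ones≤defectFrom w r 0) d≤r) ≤-refl)

  defectFrom-zeros≤ : ∀ n s u → s + u ≡ r → defectFrom s u (zeros n) ≤ r
  defectFrom-zeros≤ zero    s       u e = subst (u ≤_) e (m≤n+m u s)
  defectFrom-zeros≤ (suc n) zero    u e = defectFrom-zeros≤ n r 0 (+-identityʳ r)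
  defectFrom-zeros≤ (suc n) (suc s) u e = defectFrom-zeros≤ n s (suc u) (trans (+-suc s u) e)

  defectFrom-short : ∀ x s u → length x ≤ s → s ≤ r → defectFrom s u x ≡ u + length x
  defectFrom-short []          s       u _         _   = sym (+-identityʳ u)
  defectFrom-short (true ∷ x)  (suc s) u (s≤s l≤s) s<r =
    trans (cong (λ d → suc (u + d)) (defectFrom-short x r 0 (≤-trans l≤s (<⇒≤ s<r)) ≤-refl))
          (sym (+-suc u _))
  defectFrom-short (false ∷ x) (suc s) u (s≤s l≤s) s<r =
    trans (defectFrom-short x s (suc u) l≤s (<⇒≤ s<r)) (sym (+-suc u _))

module _ {d : ℕ} where

  [m+kn]/n≡k : ∀ m k → m < suc d → (m + k * suc d) / suc d ≡ k
  [m+kn]/n≡k m k m<n = trans (+-distrib-/-∣ʳ m (divides k refl))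
                             (cong₂ _+_ (m<n⇒m/n≡0 m<n) (m*n/n≡m k (suc d)))

  [m+kn]%n≡m : ∀ m k → m < suc d → (m + k * suc d) % suc d ≡ m
  [m+kn]%n≡m m k m<n = trans ([m+kn]%n≡m%n m k (suc d)) (m<n⇒m%n≡m m<n)

  quotient-≤ : ∀ {x a b} → suc d * a ≤ x + d → x ≤ suc d * b → a ≤ b
  quotient-≤ {x} {a} {b} upper lower = m<1+n⇒m≤n (*-cancelˡ-< (suc d) a (suc b)
    (≤-trans (s≤s upper) (≤-trans (≤-reflexive (sym (+-suc x d))) (≤-trans (+-monoˡ-≤ (suc d) lower)
      (≤-reflexive (trans (+-comm (suc d * b) (suc d)) (sym (*-suc (suc d) b))))))))

  quotient-unique : ∀ {x a b i j} → suc d * a ≡ x + i → suc d * b ≡ x + j → i ≤ d → j ≤ d → a ≡ b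
  quotient-unique {x} {i = i} {j} ea eb i≤d j≤d = ≤-antisym
    (quotient-≤ (≤-trans (≤-reflexive ea) (+-monoʳ-≤ x i≤d)) (≤-trans (m≤m+n x j) (≤-reflexive (sym eb))))
    (quotient-≤ (≤-trans (≤-reflexive eb) (+-monoʳ-≤ x j≤d)) (≤-trans (m≤m+n x i) (≤-reflexive (sym ea))))

radius : ℕ → ℕ → ℕ
radius r n = ceilDivSuc (n * r) r

radius-eq : ∀ r n → suc r * radius r n ≡ r * n + n % suc r
radius-eq r n = split {q = n / suc r} (m≡m%n+[m/n]*n n (suc r))
                      (proj₂ (m≤n⇒∃[o]m+o≡n (m<1+n⇒m≤n (m%n<n n (suc r)))))
  where
    split : ∀ {r n k q t} → n ≡ k + q * suc r → k + t ≡ r → suc r * radius r n ≡ r * n + k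
    split {k = k} {q} {t} refl refl = begin
      suc (k + t) * (((k + q * suc (k + t)) * (k + t) + (k + t)) / suc (k + t))
        ≡⟨ cong (λ c → suc (k + t) * (c / suc (k + t))) numerator ⟩
      suc (k + t) * ((t + (k + q * (k + t)) * suc (k + t)) / suc (k + t))
        ≡⟨ cong (suc (k + t) *_) ([m+kn]/n≡k t _ (s≤s (m≤n+m t k))) ⟩
      suc (k + t) * (k + q * (k + t))                       ≡⟨ solve (k ∷ q ∷ t ∷ []) ⟩
      (k + t) * (k + q * suc (k + t)) + k                  ∎
      where
        open ≡-Reasoning
        numerator : (k + q * suc (k + t)) * (k + t) + (k + t) ≡ t + (k + q * (k + t)) * suc (k + t)
        numerator = solve (k ∷ q ∷ t ∷ [])

module _ (r n : ℕ) where

  residue≤r : n % suc r ≤ r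
  residue≤r = m<1+n⇒m≤n (m%n<n n (suc r))

  farDist-length : ∀ w → length w ≡ n → suc r * farDist r r w ≡ r * n + defect r w
  farDist-length w len = trans (farDist-defect r w) (cong (λ l → r * l + defect r w) len)

  radius≤farDist : ∀ w → length w ≡ n → radius r n ≤ farDist r r w
  radius≤farDist w len = quotient-≤
    (≤-trans (≤-reflexive (radius-eq r n)) (+-monoʳ-≤ (r * n) residue≤r))
    (≤-trans (m≤m+n (r * n) (defect r w)) (≤-reflexive (sym (farDist-length w len))))

  defect-zeros≤ : defect r (zeros n) ≤ r
  defect-zeros≤ = defectFrom-zeros≤ r n r 0 (+-identityʳ r)

  zeros-vertex : Vertex r n (zeros n)
  zeros-vertex = defect≤⇒vertex r n (zeros n) (length-replicate n) defect-zeros≤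

  farDist-zeros : farDist r r (zeros n) ≡ radius r n
  farDist-zeros = quotient-unique (farDist-length (zeros n) (length-replicate n)) (radius-eq r n)
                                  defect-zeros≤ residue≤r

  zeros-isEcc : IsEcc r n (zeros n) (radius r n)
  zeros-isEcc = subst (IsEcc r n (zeros n)) farDist-zeros (isEcc-farDist r n zeros-vertex)

  radius≤isEcc : ∀ {v e} → Vertex r n v → IsEcc r n v e → radius r n ≤ e
  radius≤isEcc {v} vv ev =
    subst (radius r n ≤_) (sym (isEcc⇒≡farDist r n vv ev)) (radius≤farDist v (proj₁ vv))

  isRad-radius : IsRad r n (radius r n)
  isRad-radius = (zeros n , zeros-vertex , zeros-isEcc) , λ v e vv ev → radius≤isEcc vv ev

  isRad⇒≡radius : ∀ {ρ} → IsRad r n ρ → ρ ≡ radius r n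
  isRad⇒≡radius ((v , vv , ev) , minimal) = ≤-antisym
    (minimal (zeros n) (radius r n) zeros-vertex zeros-isEcc) (radius≤isEcc vv ev)

  inCenter⇔ : ∀ w → InCenter r n w ⇔ (length w ≡ n × defect r w ≡ n % suc r)
  inCenter⇔ w = mk⇔ to from
    where
      to : InCenter r n w → length w ≡ n × defect r w ≡ n % suc r
      to (vw , ρ , rad , ew) = proj₁ vw , +-cancelˡ-≡ (r * n) _ _ (begin
        r * n + defect r w         ≡⟨ farDist-length w (proj₁ vw) ⟨
        suc r * farDist r r w
          ≡⟨ cong (suc r *_) (trans (sym (isEcc⇒≡farDist r n vw ew)) (isRad⇒≡radius rad)) ⟩
        suc r * radius r n         ≡⟨ radius-eq r n ⟩
        r * n + n % suc r          ∎)
        where open ≡-Reasoning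
      from : length w ≡ n × defect r w ≡ n % suc r → InCenter r n w
      from (len , dw) = vw , radius r n , isRad-radius , subst (IsEcc r n w) atRadius (isEcc-farDist r n vw)
        where
          vw = defect≤⇒vertex r n w len (subst (_≤ r) (sym dw) residue≤r)
          atRadius : farDist r r w ≡ radius r n
          atRadius = *-cancelˡ-≡ _ _ (suc r)
            (trans (farDist-length w len) (trans (cong (r * n +_) dw) (sym (radius-eq r n))))

  zeros-inCenter : InCenter r n (zeros n)
  zeros-inCenter = zeros-vertex , radius r n , isRad-radius , zeros-isEcc

length-zeros-++ : ∀ j x → length (zeros j ++ x) ≡ j + length x
length-zeros-++ j x = trans (length-++ (zeros j)) (cong (_+ length x) (length-replicate j))

ones≡0⇒zeros : ∀ x → ones x ≡ 0 → x ≡ zeros (length x)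
ones≡0⇒zeros []          e = refl
ones≡0⇒zeros (false ∷ x) e = cong (false ∷_) (ones≡0⇒zeros x e)

module _ (r : ℕ) where

  defectFrom-zeros-++ : ∀ i s u x → defectFrom r (i + s) u (zeros i ++ x) ≡ defectFrom r s (i + u) x
  defectFrom-zeros-++ zero    s u x = refl
  defectFrom-zeros-++ (suc i) s u x =
    trans (defectFrom-zeros-++ i s (suc u) x) (cong (λ v → defectFrom r s v x) (+-suc i u))

  defect-block : ∀ x → defect r (zeros (suc r) ++ x) ≡ defect r x
  defect-block x = begin
    defect r (zeros (suc r) ++ x)                 ≡⟨ cong (defect r) (replicate-snoc r false x) ⟨
    defectFrom r r 0 (zeros r ++ false ∷ x)
      ≡⟨ cong (λ s → defectFrom r s 0 (zeros r ++ false ∷ x)) (+-identityʳ r) ⟨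
    defectFrom r (r + 0) 0 (zeros r ++ false ∷ x) ≡⟨ defectFrom-zeros-++ r 0 0 (false ∷ x) ⟩
    defect r x                                    ∎
    where open ≡-Reasoning

  defectFrom-++-cong : ∀ {t t'} → (∀ s u → defectFrom r s u t ≡ defectFrom r s u t') →
                       ∀ p s u → defectFrom r s u (p ++ t) ≡ defectFrom r s u (p ++ t')
  defectFrom-++-cong h []          s       u = h s u
  defectFrom-++-cong h (true ∷ p)  s       u = cong (λ d → suc (u + d)) (defectFrom-++-cong h p r 0)
  defectFrom-++-cong h (false ∷ p) zero    u = defectFrom-++-cong h p r 0
  defectFrom-++-cong h (false ∷ p) (suc s) u = defectFrom-++-cong h p s (suc u)

  data BlockInserted : Word → Word → Set where
    front    : ∀ η → BlockInserted (zeros (suc r) ++ η) η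
    afterOne : ∀ η₁ η₂ → BlockInserted (η₁ ++ true ∷ zeros (suc r) ++ η₂) (η₁ ++ true ∷ η₂)

  vee⇔ : ∀ S w → Vee r S w ⇔ (∃ λ w' → S w' × BlockInserted w w')
  vee⇔ S w = mk⇔
    (λ { (inj₁ (η , sη , refl)) → η , sη , front η
       ; (inj₂ (η₁ , η₂ , sη , refl)) → η₁ ++ true ∷ η₂ , sη , afterOne η₁ η₂ })
    (λ { (η , sη , front .η) → inj₁ (η , sη , refl)
       ; (_ , sη , afterOne η₁ η₂) → inj₂ (η₁ , η₂ , sη , refl) })

  blockInserted-length : ∀ {w w'} → BlockInserted w w' → length w ≡ suc r + length w'
  blockInserted-length (front η)         = length-zeros-++ (suc r) η
  blockInserted-length (afterOne η₁ η₂) = begin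
    length (η₁ ++ true ∷ zeros (suc r) ++ η₂)         ≡⟨ length-++ η₁ ⟩
    length η₁ + suc (length (zeros (suc r) ++ η₂))
      ≡⟨ cong (λ l → length η₁ + suc l) (length-zeros-++ (suc r) η₂) ⟩
    length η₁ + suc (suc r + length η₂)               ≡⟨ shift (length η₁) (length η₂) ⟩
    suc r + (length η₁ + suc (length η₂))             ≡⟨ cong (suc r +_) (length-++ η₁) ⟨
    suc r + length (η₁ ++ true ∷ η₂)                  ∎
    where
      open ≡-Reasoning
      shift : ∀ a b → a + suc (suc r + b) ≡ suc r + (a + suc b)
      shift a b = solve (r ∷ a ∷ b ∷ [])

  blockInserted-defect : ∀ {w w'} → BlockInserted w w' → defect r w ≡ defect r w'
  blockInserted-defect (front η)         = defect-block η
  blockInserted-defect (afterOne η₁ η₂) =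
    defectFrom-++-cong (λ s u → cong (λ d → suc (u + d)) (defect-block η₂)) η₁ r 0

  private
    blockOrShort : ∀ x s u → s + u ≡ r →
      (∃ λ η → x ≡ zeros (suc s) ++ η) ⊎
      (∃₂ λ η₁ η₂ → x ≡ η₁ ++ true ∷ zeros (suc r) ++ η₂) ⊎
      (defectFrom r s u x ≡ u + length x)
    blockOrShort [] s u e = inj₂ (inj₂ (sym (+-identityʳ u)))
    blockOrShort (true ∷ y) s u e with blockOrShort y r 0 (+-identityʳ r)
    ... | inj₁ (η₂ , refl)               = inj₂ (inj₁ ([] , η₂ , refl))
    ... | inj₂ (inj₁ (η₁ , η₂ , refl))  = inj₂ (inj₁ (true ∷ η₁ , η₂ , refl))
    ... | inj₂ (inj₂ e')                 =
      inj₂ (inj₂ (trans (cong (λ d → suc (u + d)) e') (sym (+-suc u _))))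
    blockOrShort (false ∷ y) zero u e = inj₁ (y , refl)
    blockOrShort (false ∷ y) (suc s) u e with blockOrShort y s (suc u) (trans (+-suc s u) e)
    ... | inj₁ (η₂ , refl)               = inj₁ (η₂ , refl)
    ... | inj₂ (inj₁ (η₁ , η₂ , refl))  = inj₂ (inj₁ (false ∷ η₁ , η₂ , refl))
    ... | inj₂ (inj₂ e')                 = inj₂ (inj₂ (trans e' (sym (+-suc u _))))

  blockInserted-exists : ∀ w → defect r w < length w → ∃ (BlockInserted w)
  blockInserted-exists w d<l with blockOrShort w r 0 (+-identityʳ r)
  ... | inj₁ (η , refl)              = η , front η
  ... | inj₂ (inj₁ (η₁ , η₂ , refl)) = η₁ ++ true ∷ η₂ , afterOne η₁ η₂
  ... | inj₂ (inj₂ e)                = ⊥-elim (<-irrefl e d<l)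

  inCenter-blockInserted : ∀ {n' w w'} → BlockInserted w w' →
                           InCenter r (suc r + n') w ⇔ InCenter r n' w'
  inCenter-blockInserted {n'} {w} {w'} bi = mk⇔
    (λ c → let (len , dw) = Equivalence.to (inCenter⇔ r _ w) c in
           Equivalence.from (inCenter⇔ r n' w')
             (+-cancelˡ-≡ (suc r) _ _ (trans (sym (blockInserted-length bi)) len) ,
              trans (sym (blockInserted-defect bi)) (trans dw same-residue)))
    (λ c → let (len , dw) = Equivalence.to (inCenter⇔ r n' w') c in
           Equivalence.from (inCenter⇔ r _ w)
             (trans (blockInserted-length bi) (cong (suc r +_) len) ,
              trans (blockInserted-defect bi) (trans dw (sym same-residue))))
    where
      same-residue : (suc r + n') % suc r ≡ n' % suc r
      same-residue = trans (cong (_% suc r) (+-comm (suc r) n'))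
                           (trans (cong (λ m → (n' + m) % suc r) (sym (+-identityʳ (suc r))))
                                  ([m+kn]%n≡m%n n' 1 (suc r)))

  inCenter⇔vee : ∀ n → suc r ≤ n → ∀ w → InCenter r n w ⇔ Vee r (InCenter r (n ∸ suc r)) w
  inCenter⇔vee n r<n w = subst (λ m → InCenter r m w ⇔ Vee r (InCenter r (n ∸ suc r)) w)
                                (m+[n∸m]≡n r<n) (mk⇔ to from)
    where
      n' = n ∸ suc r
      to : InCenter r (suc r + n') w → Vee r (InCenter r n') w
      to c with Equivalence.to (inCenter⇔ r _ w) c
      ... | len , dw with blockInserted-exists w (≤-<-trans (≤-reflexive dw)
                            (<-≤-trans (m%n<n (suc r + n') (suc r))
                                       (≤-trans (m≤m+n (suc r) n') (≤-reflexive (sym len)))))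
      ... | w' , bi = Equivalence.from (vee⇔ _ w) (w' , Equivalence.to (inCenter-blockInserted bi) c , bi)
      from : Vee r (InCenter r n') w → InCenter r (suc r + n') w
      from v with Equivalence.to (vee⇔ _ w) v
      ... | w' , c , bi = Equivalence.from (inCenter-blockInserted bi) c

  inCenter-divisible : ∀ n → n % suc r ≡ 0 → ∀ w → InCenter r n w ⇔ (w ≡ zeros n)
  inCenter-divisible n n%≡0 w = mk⇔
    (λ c → let (len , dw) = Equivalence.to (inCenter⇔ r n w) c in
           trans (ones≡0⇒zeros w (n≤0⇒n≡0 (≤-trans (ones≤defectFrom r w r 0)
                                                    (≤-reflexive (trans dw n%≡0)))))
                 (cong zeros len))
    (λ { refl → zeros-inCenter r n })

  inCenter-short : ∀ k → k ≤ r → ∀ w → InCenter r k w ⇔ (length w ≡ k)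
  inCenter-short k k≤r w = mk⇔ (λ c → proj₁ (Equivalence.to (inCenter⇔ r k w) c))
    (λ len → Equivalence.from (inCenter⇔ r k w)
      (len , trans (defectFrom-short r w r 0 (≤-trans (≤-reflexive len) k≤r) ≤-refl)
                   (trans len (sym (m<n⇒m%n≡m (s≤s k≤r))))))

Image : (Word → Word) → (Word → Set) → Word → Set
Image f P w = ∃ λ v → P v × w ≡ f v

hasSize-unique : ∀ {P : Word → Set} {a b} → HasSize P a → HasSize P b → a ≡ b
hasSize-unique (xs , uxs , ∈xs , refl) (ys , uys , ∈ys , refl) =
  ↭-length (∼bag⇒↭ (unique∧set⇒bag uxs uys (λ {w} → ⇔.trans (∈xs w) (⇔.sym (∈ys w)))))

hasSize-cong : ∀ {P Q : Word → Set} {c} → (∀ w → P w ⇔ Q w) → HasSize P c → HasSize Q c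
hasSize-cong P⇔Q (xs , u , ∈xs , len) = xs , u , (λ w → ⇔.trans (∈xs w) (P⇔Q w)) , len

hasSize-⊎ : ∀ {P Q : Word → Set} {a b} → (∀ w → P w → Q w → ⊥) → HasSize P a → HasSize Q b →
            HasSize (λ w → P w ⊎ Q w) (a + b)
hasSize-⊎ disjoint (xs , uxs , ∈xs , refl) (ys , uys , ∈ys , refl) =
  xs ++ ys ,
  Unique.++⁺ uxs uys (λ (p , q) → disjoint _ (Equivalence.to (∈xs _) p) (Equivalence.to (∈ys _) q)) ,
  (λ w → mk⇔ (λ p → Sum.map (Equivalence.to (∈xs w)) (Equivalence.to (∈ys w)) (∈-++⁻ xs p))
             [ (λ p → ∈-++⁺ˡ (Equivalence.from (∈xs w) p))
             , (λ q → ∈-++⁺ʳ xs (Equivalence.from (∈ys w) q)) ]) ,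
  length-++ xs

hasSize-image : ∀ {P : Word → Set} {f a} → (∀ {x y} → f x ≡ f y → x ≡ y) →
                HasSize P a → HasSize (Image f P) a
hasSize-image {f = f} injective (xs , u , ∈xs , refl) =
  map f xs , Unique.map⁺ injective u ,
  (λ w → mk⇔ (λ p → let (v , v∈ , eq) = ∈-map⁻ f p in v , Equivalence.to (∈xs v) v∈ , eq)
             (λ { (v , pv , refl) → ∈-map⁺ f (Equivalence.from (∈xs v) pv) })) ,
  length-map f xs

hasSize-empty : ∀ {P : Word → Set} → (∀ w → ¬ P w) → HasSize P 0
hasSize-empty none = [] , [] , (λ w → mk⇔ (λ ()) (λ p → ⊥-elim (none w p))) , refl

hasSize-singleton : ∀ x → HasSize (_≡ x) 1
hasSize-singleton x =
  x ∷ [] , [] ∷ [] , (λ w → mk⇔ (λ { (here refl) → refl }) (λ { refl → here refl })) , refl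

OfLength : ℕ → Word → Set
OfLength k w = length w ≡ k

ofLength-hasSize : ∀ k → HasSize (OfLength k) (2 ^ k)
ofLength-hasSize zero = hasSize-cong empty (hasSize-singleton [])
  where
    empty : ∀ w → w ≡ [] ⇔ OfLength 0 w
    empty []      = mk⇔ (λ _ → refl) (λ _ → refl)
    empty (_ ∷ _) = mk⇔ (λ ()) (λ ())
ofLength-hasSize (suc k) = subst (HasSize _) (cong (2 ^ k +_) (sym (+-identityʳ (2 ^ k))))
  (hasSize-cong split (hasSize-⊎ heads-differ (hasSize-image ∷-injectiveʳ (ofLength-hasSize k))
                                              (hasSize-image ∷-injectiveʳ (ofLength-hasSize k))))
  where
    heads-differ : ∀ w → Image (false ∷_) (OfLength k) w → Image (true ∷_) (OfLength k) w → ⊥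
    heads-differ w (_ , _ , refl) (_ , _ , ())
    split : ∀ w → (Image (false ∷_) (OfLength k) w ⊎ Image (true ∷_) (OfLength k) w) ⇔ OfLength (suc k) w
    split []          = mk⇔ (λ { (inj₁ (_ , _ , ())) ; (inj₂ (_ , _ , ())) }) (λ ())
    split (false ∷ v) = mk⇔ (λ { (inj₁ (_ , refl , refl)) → refl ; (inj₂ (_ , _ , ())) })
                            (λ e → inj₁ (v , suc-injective e , refl))
    split (true ∷ v)  = mk⇔ (λ { (inj₂ (_ , refl , refl)) → refl ; (inj₁ (_ , _ , ())) })
                            (λ e → inj₂ (v , suc-injective e , refl))

data ZerosView (c : ℕ) : Word → Set where
  block : ∀ y → ZerosView c (zeros (suc c) ++ y)
  one   : ∀ {i} y → i ≤ c → ZerosView c (zeros i ++ true ∷ y)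
  short : ∀ {i} → i ≤ c → ZerosView c (zeros i)

zerosView : ∀ c w → ZerosView c w
zerosView c       []          = short z≤n
zerosView c       (true ∷ y)  = one y z≤n
zerosView zero    (false ∷ y) = block y
zerosView (suc c) (false ∷ y) with zerosView c y
... | block y'   = block y'
... | one y' i≤c = one y' (s≤s i≤c)
... | short i≤c  = short (s≤s i≤c)

length-zeros-one : ∀ i y → length (zeros i ++ true ∷ y) ≡ suc (i + length y)
length-zeros-one i y = trans (length-zeros-++ i (true ∷ y)) (+-suc i (length y))

mutual
  centralCount : ℕ → ℕ → ℕ
  centralCount k zero    = 2 ^ k
  centralCount k (suc m) = centralCount k m + unblockedCount k m

  unblockedCount : ℕ → ℕ → ℕ
  unblockedCount zero    m = 0
  unblockedCount (suc k) m = centralCount k (suc m) + unblockedCount k m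

module _ (r : ℕ) where

  defect-zeros-one : ∀ i y → i ≤ r → defect r (zeros i ++ true ∷ y) ≡ suc (i + defect r y)
  defect-zeros-one i y i≤r with m≤n⇒∃[o]m+o≡n i≤r
  ... | s , refl = trans (defectFrom-zeros-++ (i + s) i s 0 (true ∷ y))
                         (cong (λ j → suc (j + defect (i + s) y)) (+-identityʳ i))

  Central : ℕ → ℕ → Word → Set
  Central k m w = length w ≡ k + m * suc r × defect r w ≡ k

  -- the words of Central k (suc m) that do not begin with 0^(r+1)
  Unblocked : ℕ → ℕ → Word → Set
  Unblocked k m w = ∃ λ i → ∃ λ j → ∃ λ y → suc (i + j) ≡ k × w ≡ zeros i ++ true ∷ y × Central j (suc m) y

  central-zero : ∀ {k} → k ≤ r → ∀ w → Central k 0 w ⇔ OfLength k w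
  central-zero {k} k≤r w = mk⇔ (λ (len , _) → trans len (+-identityʳ k))
    (λ len → trans len (sym (+-identityʳ k)) ,
             trans (defectFrom-short r w r 0 (≤-trans (≤-reflexive len) k≤r) ≤-refl) len)

  unblocked-zero : ∀ m w → ¬ Unblocked 0 m w
  unblocked-zero m w (_ , _ , _ , () , _)

  unblocked-suc : ∀ {k} m w → Unblocked (suc k) m w ⇔
                  (Image (true ∷_) (Central k (suc m)) w ⊎ Image (false ∷_) (Unblocked k m) w)
  unblocked-suc m w = mk⇔
    (λ { (zero  , j , y , refl , refl , cy) → inj₁ (y , cy , refl)
       ; (suc i , j , y , refl , refl , cy) →
           inj₂ (zeros i ++ true ∷ y , (i , j , y , refl , refl , cy) , refl) })
    (λ { (inj₁ (y , cy , refl)) → 0 , _ , y , refl , refl , cy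
       ; (inj₂ (_ , (i , j , y , refl , refl , cy) , refl)) → suc i , j , y , refl , refl , cy })

  central-suc : ∀ {k} m → k ≤ r → ∀ w →
                Central k (suc m) w ⇔ (Image (zeros (suc r) ++_) (Central k m) w ⊎ Unblocked k m w)
  central-suc {k} m k≤r w = mk⇔ (to (zerosView r w)) from
    where
      open ≡-Reasoning
      N = suc m * suc r

      shuffle : k + suc m * suc r ≡ suc r + (k + m * suc r)
      shuffle = solve (k ∷ m ∷ r ∷ [])

      to : ∀ {w} → ZerosView r w → Central k (suc m) w →
           Image (zeros (suc r) ++_) (Central k m) w ⊎ Unblocked k m w
      to (block y) (len , dw) = inj₁ (y , (+-cancelˡ-≡ (suc r) _ _ (begin
        suc r + length y              ≡⟨ length-zeros-++ (suc r) y ⟨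
        length (zeros (suc r) ++ y)   ≡⟨ len ⟩
        k + N                         ≡⟨ shuffle ⟩
        suc r + (k + m * suc r)       ∎) , trans (sym (defect-block r y)) dw) , refl)
      to (one {i} y i≤r) (len , dw) =
        inj₂ (i , defect r y , y , trans (sym (defect-zeros-one i y i≤r)) dw , refl ,
              +-cancelˡ-≡ (suc i) _ _ (begin
                suc (i + length y)              ≡⟨ length-zeros-one i y ⟨
                length (zeros i ++ true ∷ y)    ≡⟨ len ⟩
                k + N                           ≡⟨ cong (_+ N) (trans (sym dw) (defect-zeros-one i y i≤r)) ⟩
                suc (i + defect r y) + N        ≡⟨ cong suc (+-assoc i (defect r y) N) ⟩
                suc (i + (defect r y + N))      ∎) ,
              refl)
      to (short {i} i≤r) (len , _) = ⊥-elim (<⇒≱ (s≤s i≤r)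
        (≤-trans (m≤m+n (suc r) (m * suc r))
          (≤-trans (m≤n+m N k) (≤-reflexive (trans (sym len) (length-replicate i))))))

      from : Image (zeros (suc r) ++_) (Central k m) w ⊎ Unblocked k m w → Central k (suc m) w
      from (inj₁ (y , (len , dy) , refl)) =
        trans (length-zeros-++ (suc r) y) (trans (cong (suc r +_) len) (sym shuffle)) ,
        trans (defect-block r y) dy
      from (inj₂ (i , j , y , refl , refl , (len , dy))) =
        trans (length-zeros-one i y) (cong suc (trans (cong (i +_) len) (sym (+-assoc i j N)))) ,
        trans (defect-zeros-one i y i≤r) (cong (λ d → suc (i + d)) dy)
        where i≤r = ≤-trans (m≤m+n i j) (≤-trans (n≤1+n (i + j)) k≤r)

  private
    zeros-one≢block : ∀ {i c} y y' → i ≤ c → zeros i ++ true ∷ y ≢ zeros (suc c) ++ y'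
    zeros-one≢block {zero}  y y' _         ()
    zeros-one≢block {suc i} y y' (s≤s i≤c) eq = zeros-one≢block y y' i≤c (∷-injectiveʳ eq)

    block-unblocked-disjoint : ∀ {k} m → k ≤ r → ∀ w →
      Image (zeros (suc r) ++_) (Central k m) w → Unblocked k m w → ⊥
    block-unblocked-disjoint m k≤r w (y , _ , refl) (i , j , y' , refl , eq , _) =
      zeros-one≢block y' y (≤-trans (m≤m+n i j) (≤-trans (n≤1+n (i + j)) k≤r)) (sym eq)

    heads-differ : ∀ {P Q : Word → Set} w → Image (true ∷_) P w → Image (false ∷_) Q w → ⊥
    heads-differ w (_ , _ , refl) (_ , _ , ())

  mutual
    central-hasSize : ∀ {k} m → k ≤ r → HasSize (Central k m) (centralCount k m)
    central-hasSize zero    k≤r = hasSize-cong (λ w → ⇔.sym (central-zero k≤r w)) (ofLength-hasSize _)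
    central-hasSize (suc m) k≤r = hasSize-cong (λ w → ⇔.sym (central-suc m k≤r w))
      (hasSize-⊎ (block-unblocked-disjoint m k≤r)
                 (hasSize-image (++-cancelˡ (zeros (suc r)) _ _) (central-hasSize m k≤r))
                 (unblocked-hasSize m k≤r))

    unblocked-hasSize : ∀ {k} m → k ≤ r → HasSize (Unblocked k m) (unblockedCount k m)
    unblocked-hasSize {zero}  m _   = hasSize-empty (unblocked-zero m)
    unblocked-hasSize {suc k} m k<r = hasSize-cong (λ w → ⇔.sym (unblocked-suc m w))
      (hasSize-⊎ heads-differ
                 (hasSize-image ∷-injectiveʳ (central-hasSize (suc m) (<⇒≤ k<r)))
                 (hasSize-image ∷-injectiveʳ (unblocked-hasSize m (<⇒≤ k<r))))

  inCenter⇔central : ∀ {k} m → k ≤ r → ∀ w → InCenter r (k + m * suc r) w ⇔ Central k m w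
  inCenter⇔central {k} m k≤r w = ⇔.trans (inCenter⇔ r _ w)
    (mk⇔ (map₂ (λ dw → trans dw residue)) (map₂ (λ dw → trans dw (sym residue))))
    where residue = [m+kn]%n≡m k m (s≤s k≤r)

  inCenter-hasSize : ∀ {k} m → k ≤ r → HasSize (InCenter r (k + m * suc r)) (centralCount k m)
  inCenter-hasSize m k≤r = hasSize-cong (λ w → ⇔.sym (inCenter⇔central m k≤r w)) (central-hasSize m k≤r)


private
  unblocked-degree : ∀ d k → DegreeAtMost d (λ m → ℕtoℚ (centralCount k m)) →
                     DegreeAtMost d (λ m → ℕtoℚ (unblockedCount k m)) →
                     DegreeAtMost d (λ m → ℕtoℚ (unblockedCount (suc k) m))
  unblocked-degree d k dC dU =
    degree-cong d (degree-+ d {λ m → ℕtoℚ (centralCount k (suc m))} (degree-shift d dC) dU)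
                  (λ m → sym (ℕtoℚ-+ (centralCount k (suc m)) (unblockedCount k m)))

  central-degree : ∀ d k → DegreeAtMost d (λ m → ℕtoℚ (unblockedCount k m)) →
                   DegreeAtMost (suc d) (λ m → ℕtoℚ (centralCount k m))
  central-degree d k dU =
    degree-cong d dU (λ m → sym (Δ-increment {centralCount k} {unblockedCount k} (λ _ → refl) m))

counts-degree : ∀ k → DegreeAtMost k (λ m → ℕtoℚ (centralCount k m)) ×
                      DegreeAtMost k (λ m → ℕtoℚ (unblockedCount (suc k) m))
counts-degree zero = central₀ , unblocked-degree 0 0 central₀ (degree-const 0 (ℕtoℚ 0))
  where
    central₀ : DegreeAtMost 0 (λ m → ℕtoℚ (centralCount 0 m))
    central₀ m = cong ℕtoℚ (+-identityʳ (centralCount 0 m))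
counts-degree (suc k) with counts-degree k
... | _ , dU = dC , unblocked-degree (suc k) (suc k) dC (degree-suc k dU)
  where dC = central-degree k (suc k) dU

centralCount-polynomial : ∀ k a → (∀ i → i ≤ k → PolyEval k a (suc i) ≡ ℕtoℚ (centralCount k i)) →
                          ∀ m → ℕtoℚ (centralCount k m) ≡ PolyEval k a (suc m)
centralCount-polynomial k a agree m =
  sym (degree-agree k (polyEval-degree k a) (proj₁ (counts-degree k)) agree m)

module _ (r : ℕ) where

  ceilDivSuc-residue : ∀ k q → 1 ≤ k → k ≤ r → ceilDivSuc (k + q * suc r) r ≡ suc q
  ceilDivSuc-residue (suc k) q _ k<r =
    trans (cong (_/ suc r) regroup) ([m+kn]/n≡k k (suc q) (s≤s (<⇒≤ k<r)))
    where
      regroup : suc k + q * suc r + r ≡ k + suc q * suc r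
      regroup = solve (k ∷ q ∷ r ∷ [])

  center-size : ∀ n k → n % suc r ≡ k → k ≢ 0 → (b : Fin (suc k) → ℕ) →
    (∀ i → HasSize (InCenter r (k + toℕ i * suc r)) (b i)) →
    (c : ℕ) → HasSize (InCenter r n) c →
    (a : Fin (suc k) → ℚ) → (∀ i → VandApply k a i ≡ ℕtoℚ (b i)) →
    ℕtoℚ c ≡ PolyEval k a (ceilDivSuc n r)
  center-size n k n%≡k k≢0 b hasSize-b c hasSize-c a vand≡b = begin
    ℕtoℚ c                         ≡⟨ cong ℕtoℚ size ⟩
    ℕtoℚ (centralCount k q)        ≡⟨ centralCount-polynomial k a agree q ⟩
    PolyEval k a (suc q)           ≡⟨ cong (PolyEval k a) ceiling ⟨
    PolyEval k a (ceilDivSuc n r)  ∎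
    where
      open ≡-Reasoning
      q = n / suc r
      k≤r = subst (_≤ r) n%≡k (residue≤r r n)
      n≡ : n ≡ k + q * suc r
      n≡ = trans (m≡m%n+[m/n]*n n (suc r)) (cong (_+ q * suc r) n%≡k)
      size : c ≡ centralCount k q
      size = hasSize-unique hasSize-c
        (subst (λ n → HasSize (InCenter r n) (centralCount k q)) (sym n≡) (inCenter-hasSize r q k≤r))
      ceiling : ceilDivSuc n r ≡ suc q
      ceiling = trans (cong (λ n → ceilDivSuc n r) n≡) (ceilDivSuc-residue k q (n≢0⇒n>0 k≢0) k≤r)
      agree : ∀ i → i ≤ k → PolyEval k a (suc i) ≡ ℕtoℚ (centralCount k i)
      agree i i≤k = subst (λ j → PolyEval k a (suc j) ≡ ℕtoℚ (centralCount k j)) (toℕ-fromℕ< (s≤s i≤k))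
        (trans (sym (vandApply≡polyEval k a fi))
               (trans (vand≡b fi)
                      (cong ℕtoℚ (hasSize-unique (hasSize-b fi) (inCenter-hasSize r (toℕ fi) k≤r)))))
        where fi = fromℕ< (s≤s i≤k)

theorem4p1 : (r n : ℕ) → 1 ≤ r → 1 ≤ n →
    InCenter r n (replicate n false) ×
    IsRad r n (ceilDivSuc (n * r) r) ×
    (n % suc r ≡ 0 →
      (∀ w → InCenter r n w ⇔ (w ≡ replicate n false)) ×
      HasSize (InCenter r n) 1) ×
    ((k : ℕ) → n % suc r ≡ k → k ≢ 0 →
      (∀ w → InCenter r k w ⇔ (length w ≡ k)) ×
      (suc r ≤ n → ∀ w → InCenter r n w ⇔ Vee r (InCenter r (n ∸ suc r)) w) ×
      ((b : Fin (suc k) → ℕ) →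
        (∀ i → HasSize (InCenter r (k + toℕ i * suc r)) (b i)) →
        (c : ℕ) → HasSize (InCenter r n) c →
        (a : Fin (suc k) → ℚ) →
        (∀ i → VandApply k a i ≡ ℕtoℚ (b i)) →
        ℕtoℚ c ≡ PolyEval k a (ceilDivSuc n r)))
theorem4p1 r n _ _ =
  zeros-inCenter r n ,
  isRad-radius r n ,
  (λ n%≡0 → inCenter-divisible r n n%≡0 ,
            hasSize-cong (λ w → ⇔.sym (inCenter-divisible r n n%≡0 w)) (hasSize-singleton (zeros n))) ,
  λ k n%≡k k≢0 →
    inCenter-short r k (subst (_≤ r) n%≡k (residue≤r r n)) ,
    inCenter⇔vee r n ,
    center-size r n k n%≡k k≢0
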